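{- Let $\mathcal{F}=\langle W,R,\{S_x\}_{x\in W}\rangle$ be a Veltman frame, let $f,g$ be ultrafilters on $W$, and let $l\subseteq\wp(W)\setminus\{\emptyset\}$ have the finite intersection property. If $f\prec_l g$, then $R^{ -1}(X)\in f$ for every $X\in g$.
   Context: A Veltman frame is $\langle W,R,\{S_w\}\rangle$ where: - $W$ is nonempty. - $R$ is transitive and conversely well-founded. - Each $S_w$ is a reflexive transitive relation on $R[w]=\{v:wRv\}$ containing $R\cap R[w]^2$. For $X,Y\subseteq W$: - $\overline{Y}=W\setminus Y$. - $R^{ -1}(Y)=\{w:\exists y\in Y\,wRy\}$. - $\widehat{R^{ -1}}(Y)=\{x:\forall y(xRy\to y\in Y)\}$. - $S^{ -1}(X,Y)=\{w:\forall x\in X(wRx\to\exists y\in Y\,xS_wy)\}$. For a family $l\subseteq\wp(W)$ and ultrafilters $f,g$, $f\prec_l g$ means the following: for every $A\subseteq W$ and every finite (possibly empty) family $S_1,\dots,S_n\in l$, if $S^{ -1}(\overline{A},\overline{S_1}\cup\dots\cup\overline{S_n})\in f$ then $A\in g$ and $\widehat{R^{ -1}}(A)\in g$. -}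

module Defs where

open import Level using (0ℓ)
open import Data.Nat using (ℕ)
open import Data.Fin using (Fin)
open import Data.Product using (Σ; ∃; _×_; _,_)
open import Data.Sum using (_⊎_)
open import Data.Empty using (⊥)
import Data.Unit
open import Relation.Nullary using (¬_)
open import Induction.WellFounded using (WellFounded)

Subset : Set → Set₁
Subset W = W → Set

Family : Set → Set₁
Family W = Subset W → Set

-- Veltman frame ⟨W, R, {S_w}⟩.  S w x y  means  x S_w y.
record VeltmanFrame : Set₁ where
  field
    W      : Set
    W-ne   : W
    R      : W → W → Set
    R-trans : ∀ {x y z} → R x y → R y z → R x z
    R-cwf  : WellFounded (λ y x → R x y)
    S      : W → W → W → Set
    S-dom  : ∀ {w x y} → S w x y → R w x × R w y
    S-refl : ∀ {w x} → R w x → S w x x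
    S-trans : ∀ {w x y z} → S w x y → S w y z → S w x z
    S-R    : ∀ {w x y} → R w x → R w y → R x y → S w x y

module _ (F : VeltmanFrame) where
  open VeltmanFrame F

  co : Subset W → Subset W
  co Y w = ¬ Y w

  Rinv : Subset W → Subset W
  Rinv Y w = Σ W λ y → Y y × R w y

  Rinv-box : Subset W → Subset W
  Rinv-box Y x = ∀ y → R x y → Y y

  Sinv : Subset W → Subset W → Subset W
  Sinv X Y w = ∀ x → X x → R w x → Σ W λ y → Y y × S w x y

  coUnion : ∀ {n} → (Fin n → Subset W) → Subset W
  coUnion {n} Ss w = Σ (Fin n) λ i → ¬ Ss i w

  record Ultrafilter (f : Family W) : Set₁ where
    field
      whole   : f (λ _ → Data.Unit.⊤)
      proper  : ¬ f (λ _ → ⊥)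
      up      : ∀ {A B : Subset W} → f A → (∀ w → A w → B w) → f B
      meet    : ∀ {A B : Subset W} → f A → f B → f (λ w → A w × B w)
      ultra   : ∀ (A : Subset W) → f A ⊎ f (co A)

  NonemptyMembers : Family W → Set₁
  NonemptyMembers l = ∀ (A : Subset W) → l A → Σ W A

  FIP : Family W → Set₁
  FIP l = ∀ (n : ℕ) (Ss : Fin n → Subset W) → (∀ i → l (Ss i)) →
          Σ W λ w → ∀ i → Ss i w

  Prec : Family W → Family W → Family W → Set₁
  Prec l f g = ∀ (A : Subset W) (n : ℕ) (Ss : Fin n → Subset W) →
               (∀ i → l (Ss i)) →
               f (Sinv (co A) (coUnion Ss)) →
               g A × g (Rinv-box A)

-- If R⁻¹(X) ∉ f, its complement lies in f.  A world with no R-successor in X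
-- belongs vacuously to S⁻¹(X̄̄, Y) for every Y, in particular for the empty
-- union of complements; so f ≺_l g, applied to A = X̄ and the empty family,
-- puts X̄ into g, contradicting X ∈ g.
module Submission where

open import Defs
open import Data.Product using (_,_; proj₁)
open import Data.Sum using (inj₁; inj₂)
open import Data.Empty using (⊥-elim)
open import Data.Vec.Functional using ([])
open import Relation.Nullary using (¬_)

module _ (F : VeltmanFrame) where
  open VeltmanFrame F using (W)

  ultrafilter-∉-co : ∀ {f : Family W} {A : Subset W} →
                     Ultrafilter F f → f A → ¬ f (co F A)
  ultrafilter-∉-co uf fA fĀ =
    proper (up (meet fA fĀ) (λ _ (a , ¬a) → ¬a a))
    where open Ultrafilter uf

  co-Rinv⊆Sinv-co-co : ∀ (X Y : Subset W) w →
                       co F (Rinv F X) w → Sinv F (co F (co F X)) Y w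
  co-Rinv⊆Sinv-co-co X Y w ¬wRX x ¬¬Xx wRx =
    ⊥-elim (¬¬Xx (λ Xx → ¬wRX (x , Xx , wRx)))

  Prec-nullary : ∀ {l f g : Family W} {A : Subset W} →
                 Prec F l f g → f (Sinv F (co F A) (coUnion F [])) → g A
  Prec-nullary prec fS = proj₁ (prec _ 0 [] (λ ()) fS)

lemma5p1 : (F : VeltmanFrame) (f g : Family (VeltmanFrame.W F)) (l : Family (VeltmanFrame.W F)) →
    Ultrafilter F f → Ultrafilter F g →
    NonemptyMembers F l → FIP F l →
    Prec F l f g →
    ∀ (X : Subset (VeltmanFrame.W F)) → g X → f (Rinv F X)
lemma5p1 F f g l uf ug _ _ prec X gX with Ultrafilter.ultra uf (Rinv F X)
... | inj₁ fRX  = fRX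
... | inj₂ f¬RX = ⊥-elim (ultrafilter-∉-co F ug gX (Prec-nullary F {l} {f} {g} prec fS))
  where
  fS : f (Sinv F (co F (co F X)) (coUnion F []))
  fS = Ultrafilter.up uf f¬RX (co-Rinv⊆Sinv-co-co F X _)
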